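{- Let $\mathcal{T}$ be a BSTSO instance in which every tree has $2$, $3$ or $4$ elements, with $\mathcal{T}^{\mathrm{depth}\le2}=\mathcal{T}_2\cup\mathcal{T}_3'\cup\mathcal{T}_4^{\mathrm{depth}2}$ and the hypergraph $H$ as defined below. Then the minimum size $\mathrm{opt}_{\mathrm{VC}}$ of a vertex cover in $H$ satisfies $$\mathrm{opt}_{\mathrm{VC}}=\mathrm{opt}(\mathcal{T}^{\mathrm{depth}\le2})-|\mathcal{T}_3'\cup\mathcal{T}_4^{\mathrm{depth}2}|.$$
   Context: BSTSO: Fix an associative, commutative binary operator $\circ$ on $\{0,1\}$. An instance is a finite family of subsets of $\{1,\dots,n\}$ (trees). A circuit is a directed acyclic graph with inputs (in-degree $0$, each associated with a variable $x_i$) and gates (in-degree $2$); each vertex $v$ has a variable set $S(v)$, with $S(v)=\{i\}$ for the input of $x_i$ and, for a gate with predecessors $u,w$, $S(u)\cap S(w)=\emptyset$ and $S(v)=S(u)\cup S(w)$. A solution for a family is a circuit in which every member equals $S(v)$ for some vertex $v$; $\mathrm{opt}(\cdot)$ is the minimum number of gates of a solution. Sets: $\mathcal{T}_i:=\{T\in\mathcal{T}:|T|=i\}$; $\mathcal{T}^{\supsetneq 3}:=\{T\in\mathcal{T}_4:\exists T'\in\mathcal{T}_3,\ T'\subsetneq T\}$; $\mathcal{T}^{\mathrm{intersect}}$: start with $B:=\mathcal{T}^{\supsetneq 3}$ and, while there exist $\ell\ge3$ distinct $T_1,\dots,T_\ell\in\mathcal{T}_4\setminus B$ with $|T_1\cap\dots\cap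 T_\ell|=3$, add such trees to $B$; $\mathcal{T}^{\mathrm{intersect}}$ is the set of trees added in this loop. Let $G$ be the graph with vertex set $\mathcal{T}_4\setminus(\mathcal{T}^{\supsetneq 3}\cup\mathcal{T}^{\mathrm{intersect}})$ and edges $\{T,T'\}$ with $|T\cap T'|=3$; $M^{\max}$ a maximum matching in $G$, $\mathcal{T}_4^{\mathrm{matching}}$ the trees it covers, $\mathcal{T}_4^{\mathrm{depth}2}:=\mathcal{T}_4\setminus(\mathcal{T}^{\supsetneq 3}\cup\mathcal{T}^{\mathrm{intersect}}\cup\mathcal{T}_4^{\mathrm{matching}})$, $\mathcal{T}_3':=\mathcal{T}_3\cup\{T\cap T':\{T,T'\}\in M^{\max}\}$. Hypergraph $H$: vertex set = all $2$-element subsets $U$ of trees in $\mathcal{T}^{\mathrm{depth}\le2}$; hyperedges: (a) for each $T=\{a,b,c,d\}\in\mathcal{T}_4^{\mathrm{depth}2}$, consider the three complementary pairs $(\{a,b\},\{c,d\})$, $(\{a,c\},\{b,d\})$, $(\{a,d\},\{b,c\})$, and add all $8$ hyperedges that contain exactly one set from each pair; (b) for each $T\in\mathcal{T}_3'$, the hyperedge consisting of the three $2$-element subsets of $T$; (c) for each $T\in\mathcal{T}_2$, the hyperedge $\{T\}$. A vertex cover of $H$ is a set of vertices meeting every hyperedge. -}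

module Defs where

open import Data.Nat using (ℕ; _+_; _≤_)
open import Data.Fin using (Fin)
open import Data.Fin.Subset using (Subset; ⁅_⁆; ∣_∣; Empty; _∩_; _∪_; _⊆_; ⊤)
open import Data.List using (List; []; _∷_; length; foldr)
open import Data.List.Membership.Propositional using (_∈_)
open import Data.List.Relation.Unary.All using (All)
open import Data.List.Relation.Unary.Any using (Any)
open import Data.List.Relation.Unary.AllPairs using (AllPairs)
open import Data.List.Relation.Unary.Unique.Propositional using (Unique)
open import Data.Product using (Σ; ∃; ∃₂; _×_; _,_; proj₁; proj₂)
open import Data.Sum using (_⊎_)
open import Data.Bool using (Bool; true; false)
open import Relation.Binary.PropositionalEquality using (_≡_; _≢_)
open import Relation.Nullary using (¬_)
open import Level using () renaming (suc to lsuc; zero to lzero)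

-- A family of subsets of the variable set {1..n} (here: Fin n) is a predicate
-- on Subset n; the instance itself is given as a finite list.
Family : ℕ → Set₁
Family n = Subset n → Set

-- A circuit is represented by the list of the variable sets S(v) of its gates,
-- newest gate first (a topological order).  Input vertices for all variables
-- are always available and have S = {i}.
Available : ∀ {n} → List (Subset n) → Subset n → Set
Available gs s = (∃ λ i → s ≡ ⁅ i ⁆) ⊎ s ∈ gs

Disjoint : ∀ {n} → Subset n → Subset n → Set
Disjoint u w = Empty (u ∩ w)

data IsCircuit {n : ℕ} : List (Subset n) → Set where
  noGates : IsCircuit []
  addGate : ∀ {gs s} (u w : Subset n) →
            Available gs u → Available gs w → Disjoint u w → s ≡ u ∪ w →
            IsCircuit gs → IsCircuit (s ∷ gs)

IsSolution : ∀ {n} → Family n → List (Subset n) → Set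
IsSolution F gs = IsCircuit gs × (∀ T → F T → Available gs T)

IsOpt : ∀ {n} → Family n → ℕ → Set
IsOpt F k = (∃ λ gs → IsSolution F gs × length gs ≡ k)
          × (∀ gs → IsSolution F gs → k ≤ length gs)

module _ {n : ℕ} (𝒯 : List (Subset n)) where

  Tsize : ℕ → Family n
  Tsize i T = T ∈ 𝒯 × ∣ T ∣ ≡ i

  Sup3 : Family n
  Sup3 T = Tsize 4 T × ∃ λ T' → Tsize 3 T' × T' ⊆ T × T' ≢ T

  ⋂ : List (Subset n) → Subset n
  ⋂ = foldr _∩_ ⊤

  Group : Family n → List (Subset n) → Set
  Group B Ts = 3 ≤ length Ts × Unique Ts
             × All (λ T → Tsize 4 T × ¬ B T) Ts × ∣ ⋂ Ts ∣ ≡ 3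

  -- A terminating run of the loop, from current B to final B.
  data IntersectRun : Family n → Family n → Set₁ where
    done : ∀ {B} → ¬ (∃ λ Ts → Group B Ts) → IntersectRun B B
    step : ∀ {B B'} (Ts : List (Subset n)) → Group B Ts →
           IntersectRun (λ T → B T ⊎ T ∈ Ts) B' → IntersectRun B B'

  -- 𝒯^{intersect} for the final set Bfin of a run started at 𝒯^{⊋3}
  Inter : Family n → Family n
  Inter Bfin T = Bfin T × ¬ Sup3 T

  GVert : Family n → Family n
  GVert Bfin T = Tsize 4 T × ¬ Sup3 T × ¬ Inter Bfin T

  EdgesDisjoint : Subset n × Subset n → Subset n × Subset n → Set
  EdgesDisjoint (a , b) (c , d) = a ≢ c × a ≢ d × b ≢ c × b ≢ d

  IsMatching : Family n → List (Subset n × Subset n) → Set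
  IsMatching Bfin M =
    All (λ e → GVert Bfin (proj₁ e) × GVert Bfin (proj₂ e)
               × ∣ proj₁ e ∩ proj₂ e ∣ ≡ 3) M
    × AllPairs EdgesDisjoint M

  IsMaxMatching : Family n → List (Subset n × Subset n) → Set
  IsMaxMatching Bfin M = IsMatching Bfin M
    × (∀ M' → IsMatching Bfin M' → length M' ≤ length M)

  Covered : List (Subset n × Subset n) → Family n
  Covered M T = ∃ λ e → e ∈ M × (proj₁ e ≡ T ⊎ proj₂ e ≡ T)

  Depth2 : Family n → List (Subset n × Subset n) → Family n
  Depth2 Bfin M T = Tsize 4 T × ¬ Sup3 T × ¬ Inter Bfin T × ¬ Covered M T

  T3' : List (Subset n × Subset n) → Family n
  T3' M T = Tsize 3 T ⊎ (∃ λ e → e ∈ M × T ≡ proj₁ e ∩ proj₂ e)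

  DepthLe2 : Family n → List (Subset n × Subset n) → Family n
  DepthLe2 Bfin M T = Tsize 2 T ⊎ T3' M T ⊎ Depth2 Bfin M T

  pair : Fin n → Fin n → Subset n
  pair a b = ⁅ a ⁆ ∪ ⁅ b ⁆

  pick : Bool → Subset n → Subset n → Subset n
  pick true  x y = x
  pick false x y = y

  HVertex : Family n → List (Subset n × Subset n) → Subset n → Set
  HVertex Bfin M U = ∃ λ T → DepthLe2 Bfin M T × U ⊆ T × ∣ U ∣ ≡ 2

  data HEdge (Bfin : Family n) (M : List (Subset n × Subset n)) :
             List (Subset n) → Set where
    edge4 : ∀ {T} (a b c d : Fin n) →
            a ≢ b → a ≢ c → a ≢ d → b ≢ c → b ≢ d → c ≢ d →
            T ≡ pair a b ∪ pair c d → Depth2 Bfin M T →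
            (β₁ β₂ β₃ : Bool) →
            HEdge Bfin M (pick β₁ (pair a b) (pair c d)
                          ∷ pick β₂ (pair a c) (pair b d)
                          ∷ pick β₃ (pair a d) (pair b c) ∷ [])
    edge3 : ∀ {T} (a b c : Fin n) → a ≢ b → a ≢ c → b ≢ c →
            T ≡ pair a b ∪ ⁅ c ⁆ → T3' M T →
            HEdge Bfin M (pair a b ∷ pair a c ∷ pair b c ∷ [])
    edge2 : ∀ {T} → Tsize 2 T → HEdge Bfin M (T ∷ [])

  IsVC : Family n → List (Subset n × Subset n) → List (Subset n) → Set
  IsVC Bfin M C = All (HVertex Bfin M) C
    × (∀ E → HEdge Bfin M E → Any (λ X → X ∈ C) E)

  IsOptVC : Family n → List (Subset n × Subset n) → ℕ → Set
  IsOptVC Bfin M k = (∃ λ C → IsVC Bfin M C × Unique C × length C ≡ k)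
    × (∀ C → IsVC Bfin M C → Unique C → k ≤ length C)

{-# OPTIONS --safe #-}
module Submission where

-- Upper bound: given a vertex cover C of H, the pairs in C are gates on two inputs, and then every tree of
-- 𝒯₃′ ∪ 𝒯₄^{depth2} is a single further gate: the hyperedge of a 3-tree forces one of its pairs into C, and
-- the eight hyperedges of a 4-tree force both halves of one of its three splittings into pairs into C.
-- Lower bound: all trees of 𝒯^{depth≤2} are gates of an optimal circuit.  Charge every gate with at most one
-- pair: a 2-gate with itself, and a 3-gate Y inside a tree T of 𝒯₄^{depth2} with T minus the 2-input of Y.
-- The charged pairs cover H, since the circuit splits each 3- and 4-tree through 2-gates as above, and the
-- trees of 𝒯₃′ ∪ 𝒯₄^{depth2} themselves are charged nothing.  This rests on two properties of the
-- instance: no tree of 𝒯₃′ lies inside a tree of 𝒯₄^{depth2} (that tree would be in 𝒯^{⊋3}, or would form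
-- a group for the intersection loop with the matched pair), and a 3-set lies inside at most one tree of
-- 𝒯₄^{depth2} (two such trees would extend the maximum matching).

open import Defs
open import Algebra.Bundles using (CommutativeMonoid)
import Algebra.Properties.CommutativeSemigroup as CommutativeSemigroupProperties
open import Data.Bool using (Bool; true; false)
import Data.Bool.Properties as Bool
open import Data.Fin using (Fin; zero; suc)
open import Data.Fin.Subset
  using (Subset; ⁅_⁆; ∣_∣; Nonempty; _∩_; _∪_; _─_; _-_; _⊆_; ⊤; inside; outside)
  renaming (_∈_ to _∈ₛ_; _∉_ to _∉ₛ_)
open import Data.Fin.Subset.Properties
  using ( drop-∷-Empty; Empty-unique; nonempty?; ∣⊥∣≡0; x∈⁅x⁆; x∈⁅y⁆⇒x≡y; x≢y⇒x∉⁅y⁆; x∉⁅y⁆⇒x≢y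
        ; ∣⁅x⁆∣≡1; ⊆-antisym; _⊆?_; p⊂q⇒∣p∣<∣q∣; p⊆q⇒∣p∣≤∣q∣; _∈?_; ∩-comm; ∩-idem; ∩-identityʳ
        ; p∩q⊆p; p∩q⊆q; x∈p∩q⁺; x∈p∩q⁻; ∪-assoc; ∪-comm; ∪-commutativeMonoid; p⊆p∪q; q⊆p∪q
        ; x∈p∪q⁻; ∣p∣≤∣p∪q∣; x∈p∧x∉q⇒x∈p─q; p─q⊆p )
open import Data.List using (List; []; _∷_; _++_; length; map; filter; mapMaybe; deduplicate)
open import Data.List.Properties
  using (filter-notAll; length-++; length-map; length-filter; length-deduplicate; ++-identityʳ)
open import Data.List.Membership.Propositional using (_∈_; _∉_; find; lose)
open import Data.List.Membership.Propositional.Properties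
  using (∈-++⁺ˡ; ∈-++⁺ʳ; ∈-map⁺; ∈-filter⁺; ∈-filter⁻; ∈-deduplicate⁺; ∈-deduplicate⁻)
open import Data.List.Membership.DecPropositional using () renaming (_∈?_ to ∈?[_])
open import Data.List.Relation.Unary.All as All using (All; []; _∷_)
open import Data.List.Relation.Unary.AllPairs using ([]; _∷_)
open import Data.List.Relation.Unary.Any as Any using (Any; here; there; any?)
open import Data.List.Relation.Unary.Unique.Propositional using (Unique)
open import Data.List.Relation.Unary.Unique.DecPropositional.Properties using (deduplicate-!)
open import Data.Maybe using (Maybe; just; nothing)
open import Data.Maybe.Properties using (just-injective)
open import Data.Nat using (ℕ; zero; suc; _+_; _∸_; _≤_; _<_; z≤n; s≤s; _≟_)
open import Data.Nat.Properties as ℕ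
  using ( ≤-trans; ≤-reflexive; <⇒≱; +-suc; m+n∸m≡n; m+n∸n≡m; m≤n⇒m≤1+n; ≤-antisym; ≤-pred
        ; <-irrefl; +-mono-≤ )
open import Data.Product using (∃; ∃₂; _×_; _,_; proj₁; proj₂)
open import Data.Sum using (_⊎_; inj₁; inj₂)
open import Data.Vec using ([]; _∷_; here; there)
open import Data.Vec.Properties using (≡-dec)
open import Function.Bundles using (_⇔_; Equivalence)
open import Relation.Binary.Definitions using (DecidableEquality)
open import Relation.Binary.PropositionalEquality
  using (_≡_; _≢_; refl; sym; trans; cong; cong₂; subst; ≢-sym; module ≡-Reasoning)
open import Relation.Nullary using (¬_; yes; no; contradiction)
open import Relation.Nullary.Decidable using (_×-dec_; _⊎-dec_; ¬?)
open import Relation.Unary using (Pred; Decidable)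

-- Lists

Unique-⊆⇒length≤ : ∀ {A : Set} {xs ys : List A} → DecidableEquality A →
                   Unique xs → All (_∈ ys) xs → length xs ≤ length ys
Unique-⊆⇒length≤ _≟_ [] [] = z≤n
Unique-⊆⇒length≤ {ys = ys} _≟_ (x∉xs ∷ xs!) (x∈ys ∷ xs⊆ys) =
  ≤-trans (s≤s (Unique-⊆⇒length≤ _≟_ xs! xs⊆ys-x))
          (filter-notAll x≢? ys (Any.map (λ x≡y x≢y → x≢y x≡y) x∈ys))
  where
  x≢? = λ y → ¬? (_ ≟ y)
  xs⊆ys-x = All.tabulate λ z∈xs → ∈-filter⁺ x≢? (All.lookup xs⊆ys z∈xs) (All.lookup x∉xs z∈xs)

∈-mapMaybe⁺ : ∀ {A B : Set} (f : A → Maybe B) {xs : List A} {x : A} {y : B} →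
              x ∈ xs → f x ≡ just y → y ∈ mapMaybe f xs
∈-mapMaybe⁺ f {xs = x ∷ xs} (here refl) fx≡y with f x
... | just _ = here (just-injective (sym fx≡y))
∈-mapMaybe⁺ f {xs = x ∷ xs} (there x∈xs) fx≡y with f x
... | just _  = there (∈-mapMaybe⁺ f x∈xs fx≡y)
... | nothing = ∈-mapMaybe⁺ f x∈xs fx≡y

length-filter+mapMaybe≤ : ∀ {ℓ} {A B : Set} {P : Pred A ℓ} (P? : Decidable P) (f : A → Maybe B) →
                          (∀ {x} → P x → f x ≡ nothing) →
                          ∀ xs → length (filter P? xs) + length (mapMaybe f xs) ≤ length xs
length-filter+mapMaybe≤ P? f P⇒nothing [] = z≤n
length-filter+mapMaybe≤ P? f P⇒nothing (x ∷ xs)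
  with ih ← length-filter+mapMaybe≤ P? f P⇒nothing xs | P? x | f x in fx≡
... | yes _  | nothing = s≤s ih
... | yes Px | just _  = contradiction (trans (sym fx≡) (P⇒nothing Px)) λ ()
... | no _   | nothing = m≤n⇒m≤1+n ih
... | no _   | just _  = subst (_≤ suc (length xs)) (sym (+-suc _ _)) (s≤s ih)

-- Finite sets

private variable
  n : ℕ
  p q r : Subset n
  a b c d x y : Fin n

-- Definitionally equal to Defs' pair 𝒯 a b, which does not depend on 𝒯.
doubleton : Fin n → Fin n → Subset n
doubleton a b = ⁅ a ⁆ ∪ ⁅ b ⁆

∣p∪q∣≡∣p∣+∣q∣ : ∀ (p q : Subset n) → Disjoint p q → ∣ p ∪ q ∣ ≡ ∣ p ∣ + ∣ q ∣
∣p∪q∣≡∣p∣+∣q∣ []             []             _    = refl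
∣p∪q∣≡∣p∣+∣q∣ (inside ∷ p)  (inside ∷ q)  p∩q=∅ = contradiction (zero , here) p∩q=∅
∣p∪q∣≡∣p∣+∣q∣ (inside ∷ p)  (outside ∷ q) p∩q=∅ =
  cong suc (∣p∪q∣≡∣p∣+∣q∣ p q (drop-∷-Empty p∩q=∅))
∣p∪q∣≡∣p∣+∣q∣ (outside ∷ p) (inside ∷ q)  p∩q=∅ =
  trans (cong suc (∣p∪q∣≡∣p∣+∣q∣ p q (drop-∷-Empty p∩q=∅))) (sym (+-suc ∣ p ∣ ∣ q ∣))
∣p∪q∣≡∣p∣+∣q∣ (outside ∷ p) (outside ∷ q) p∩q=∅ = ∣p∪q∣≡∣p∣+∣q∣ p q (drop-∷-Empty p∩q=∅)

p⊆q∧∣q∣≤∣p∣⇒p≡q : p ⊆ q → ∣ q ∣ ≤ ∣ p ∣ → p ≡ q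
p⊆q∧∣q∣≤∣p∣⇒p≡q {p = p} {q} p⊆q ∣q∣≤∣p∣ = ⊆-antisym p⊆q q⊆p
  where
  q⊆p : q ⊆ p
  q⊆p {x} x∈q with x ∈? p
  ... | yes x∈p = x∈p
  ... | no  x∉p = contradiction ∣q∣≤∣p∣ (<⇒≱ (p⊂q⇒∣p∣<∣q∣ (p⊆q , x , x∈q , x∉p)))

∣p∣≡1+k⇒Nonempty : ∀ {n k} {p : Subset n} → ∣ p ∣ ≡ suc k → Nonempty p
∣p∣≡1+k⇒Nonempty {n} {p = p} ∣p∣≡1+k with nonempty? p
... | yes p≠∅ = p≠∅
... | no  p=∅ = contradiction (trans (sym ∣p∣≡1+k) (trans (cong ∣_∣ (Empty-unique p=∅)) (∣⊥∣≡0 n))) λ ()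

disjoint : (∀ {x} → x ∈ₛ p → x ∉ₛ q) → Disjoint p q
disjoint {p = p} {q} p∩q⊆∅ (x , x∈p∩q) = let x∈p , x∈q = x∈p∩q⁻ p q x∈p∩q in p∩q⊆∅ x∈p x∈q

Disjoint-sym : Disjoint p q → Disjoint q p
Disjoint-sym {p = p} {q} p∩q=∅ (x , x∈q∩p) = p∩q=∅ (x , subst (x ∈ₛ_) (∩-comm q p) x∈q∩p)

x∈p─q⇒x∉q : x ∈ₛ p ─ q → x ∉ₛ q
x∈p─q⇒x∉q {p = _ ∷ _} {inside ∷ _} ()            here
x∈p─q⇒x∉q {p = _ ∷ _} {_ ∷ _}      (there x∈p─q) (there x∈q) = x∈p─q⇒x∉q x∈p─q x∈q

p⊆q⇒q≡p∪q─p : p ⊆ q → q ≡ p ∪ (q ─ p)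
p⊆q⇒q≡p∪q─p {p = p} {q} p⊆q = ⊆-antisym q⊆p∪q─p p∪q─p⊆q
  where
  q⊆p∪q─p : q ⊆ p ∪ (q ─ p)
  q⊆p∪q─p {x} x∈q with x ∈? p
  ... | yes x∈p = p⊆p∪q (q ─ p) x∈p
  ... | no  x∉p = q⊆p∪q p (q ─ p) (x∈p∧x∉q⇒x∈p─q x∈q x∉p)
  p∪q─p⊆q : p ∪ (q ─ p) ⊆ q
  p∪q─p⊆q {x} x∈ with x∈p∪q⁻ p (q ─ p) x∈
  ... | inj₁ x∈p   = p⊆q x∈p
  ... | inj₂ x∈q─p = p─q⊆p q p x∈q─p

Disjoint-─ : ∀ (p q : Subset n) → Disjoint p (q ─ p)
Disjoint-─ p q = disjoint λ x∈p x∈q─p → x∈p─q⇒x∉q x∈q─p x∈p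

∣q─p∣ : p ⊆ q → ∣ q ─ p ∣ ≡ ∣ q ∣ ∸ ∣ p ∣
∣q─p∣ {p = p} {q} p⊆q = sym (begin
  ∣ q ∣ ∸ ∣ p ∣                 ≡⟨ cong (λ r → ∣ r ∣ ∸ ∣ p ∣) (p⊆q⇒q≡p∪q─p p⊆q) ⟩
  ∣ p ∪ (q ─ p) ∣ ∸ ∣ p ∣       ≡⟨ cong (_∸ ∣ p ∣) (∣p∪q∣≡∣p∣+∣q∣ p (q ─ p) (Disjoint-─ p q)) ⟩
  ∣ p ∣ + ∣ q ─ p ∣ ∸ ∣ p ∣     ≡⟨ m+n∸m≡n ∣ p ∣ ∣ q ─ p ∣ ⟩
  ∣ q ─ p ∣                     ∎)
  where open ≡-Reasoning

x∈p-y⇒x≢y : x ∈ₛ p - y → x ≢ y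
x∈p-y⇒x≢y x∈p-y = x∉⁅y⁆⇒x≢y (x∈p─q⇒x∉q x∈p-y)

∈-doubletonˡ : ∀ (a b : Fin n) → a ∈ₛ doubleton a b
∈-doubletonˡ a b = p⊆p∪q ⁅ b ⁆ (x∈⁅x⁆ a)

∈-doubletonʳ : ∀ (a b : Fin n) → b ∈ₛ doubleton a b
∈-doubletonʳ a b = q⊆p∪q ⁅ a ⁆ ⁅ b ⁆ (x∈⁅x⁆ b)

∈-doubleton⁻ : x ∈ₛ doubleton a b → x ≡ a ⊎ x ≡ b
∈-doubleton⁻ {a = a} {b} x∈ with x∈p∪q⁻ ⁅ a ⁆ ⁅ b ⁆ x∈
... | inj₁ x∈⁅a⁆ = inj₁ (x∈⁅y⁆⇒x≡y a x∈⁅a⁆)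
... | inj₂ x∈⁅b⁆ = inj₂ (x∈⁅y⁆⇒x≡y b x∈⁅b⁆)

∉-doubleton : x ≢ a → x ≢ b → x ∉ₛ doubleton a b
∉-doubleton x≢a x≢b x∈ with ∈-doubleton⁻ x∈
... | inj₁ x≡a = x≢a x≡a
... | inj₂ x≡b = x≢b x≡b

doubleton⊆ : a ∈ₛ p → b ∈ₛ p → doubleton a b ⊆ p
doubleton⊆ a∈p b∈p x∈ with ∈-doubleton⁻ x∈
... | inj₁ refl = a∈p
... | inj₂ refl = b∈p

Disjoint-singletons : a ≢ b → Disjoint ⁅ a ⁆ ⁅ b ⁆
Disjoint-singletons {a = a} a≢b =
  disjoint λ x∈⁅a⁆ → x≢y⇒x∉⁅y⁆ λ x≡b → a≢b (trans (sym (x∈⁅y⁆⇒x≡y a x∈⁅a⁆)) x≡b)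

∣doubleton∣ : a ≢ b → ∣ doubleton a b ∣ ≡ 2
∣doubleton∣ {a = a} {b} a≢b = begin
  ∣ ⁅ a ⁆ ∪ ⁅ b ⁆ ∣     ≡⟨ ∣p∪q∣≡∣p∣+∣q∣ ⁅ a ⁆ ⁅ b ⁆ (Disjoint-singletons a≢b) ⟩
  ∣ ⁅ a ⁆ ∣ + ∣ ⁅ b ⁆ ∣ ≡⟨ cong₂ _+_ (∣⁅x⁆∣≡1 a) (∣⁅x⁆∣≡1 b) ⟩
  2                     ∎
  where open ≡-Reasoning

doubleton-unique : a ≢ b → a ∈ₛ p → b ∈ₛ p → ∣ p ∣ ≡ 2 → p ≡ doubleton a b
doubleton-unique a≢b a∈p b∈p ∣p∣≡2 =
  sym (p⊆q∧∣q∣≤∣p∣⇒p≡q (doubleton⊆ a∈p b∈p) (≤-reflexive (trans ∣p∣≡2 (sym (∣doubleton∣ a≢b)))))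

⊆-doubleton : a ≢ b → p ⊆ doubleton a b → ∣ p ∣ ≡ 2 → p ≡ doubleton a b
⊆-doubleton a≢b p⊆ab ∣p∣≡2 = p⊆q∧∣q∣≤∣p∣⇒p≡q p⊆ab (≤-reflexive (trans (∣doubleton∣ a≢b) (sym ∣p∣≡2)))

Distinct₃ : Fin n → Fin n → Fin n → Set
Distinct₃ a b c = a ≢ b × a ≢ c × b ≢ c

Distinct₄ : Fin n → Fin n → Fin n → Fin n → Set
Distinct₄ a b c d = a ≢ b × a ≢ c × a ≢ d × b ≢ c × b ≢ d × c ≢ d

x∈p⇒⁅x⁆⊆p : x ∈ₛ p → ⁅ x ⁆ ⊆ p
x∈p⇒⁅x⁆⊆p {x = x} {p} x∈p y∈⁅x⁆ = subst (_∈ₛ p) (sym (x∈⁅y⁆⇒x≡y x y∈⁅x⁆)) x∈p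

∈-triple : ∀ (a b c : Fin n) → let T = doubleton a b ∪ ⁅ c ⁆ in a ∈ₛ T × b ∈ₛ T × c ∈ₛ T
∈-triple a b c = p⊆p∪q ⁅ c ⁆ (∈-doubletonˡ a b) , p⊆p∪q ⁅ c ⁆ (∈-doubletonʳ a b) ,
                 q⊆p∪q (doubleton a b) ⁅ c ⁆ (x∈⁅x⁆ c)

∈-triple⁻ : x ∈ₛ doubleton a b ∪ ⁅ c ⁆ → x ≡ a ⊎ x ≡ b ⊎ x ≡ c
∈-triple⁻ {a = a} {b} {c} x∈ with x∈p∪q⁻ (doubleton a b) ⁅ c ⁆ x∈
... | inj₂ x∈⁅c⁆ = inj₂ (inj₂ (x∈⁅y⁆⇒x≡y c x∈⁅c⁆))
... | inj₁ x∈ab with ∈-doubleton⁻ x∈ab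
...   | inj₁ x≡a = inj₁ x≡a
...   | inj₂ x≡b = inj₂ (inj₁ x≡b)

doubleton⊆triple : Distinct₃ a b c → p ⊆ doubleton a b ∪ ⁅ c ⁆ → ∣ p ∣ ≡ 2 →
                   p ≡ doubleton a b ⊎ p ≡ doubleton a c ⊎ p ≡ doubleton b c
doubleton⊆triple {a = a} {b} {c} {p} (a≢b , a≢c , b≢c) p⊆abc ∣p∣≡2 with a ∈? p | b ∈? p
... | yes a∈p | yes b∈p = inj₁ (doubleton-unique a≢b a∈p b∈p ∣p∣≡2)
... | yes _   | no  b∉p = inj₂ (inj₁ (⊆-doubleton a≢c p⊆ac ∣p∣≡2))
  where
  p⊆ac : p ⊆ doubleton a c
  p⊆ac x∈p with ∈-triple⁻ (p⊆abc x∈p)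
  ... | inj₁ refl        = ∈-doubletonˡ a c
  ... | inj₂ (inj₁ refl) = contradiction x∈p b∉p
  ... | inj₂ (inj₂ refl) = ∈-doubletonʳ a c
... | no  a∉p | _       = inj₂ (inj₂ (⊆-doubleton b≢c p⊆bc ∣p∣≡2))
  where
  p⊆bc : p ⊆ doubleton b c
  p⊆bc x∈p with ∈-triple⁻ (p⊆abc x∈p)
  ... | inj₁ refl        = contradiction x∈p a∉p
  ... | inj₂ (inj₁ refl) = ∈-doubletonˡ b c
  ... | inj₂ (inj₂ refl) = ∈-doubletonʳ b c

⁅a⁆∪[bc∪d] : ∀ (a b c d : Fin n) → ⁅ a ⁆ ∪ (doubleton b c ∪ ⁅ d ⁆) ≡ doubleton a b ∪ doubleton c d
⁅a⁆∪[bc∪d] a b c d = begin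
  ⁅ a ⁆ ∪ ((⁅ b ⁆ ∪ ⁅ c ⁆) ∪ ⁅ d ⁆)       ≡⟨ cong (⁅ a ⁆ ∪_) (∪-assoc ⁅ b ⁆ ⁅ c ⁆ ⁅ d ⁆) ⟩
  ⁅ a ⁆ ∪ (⁅ b ⁆ ∪ (⁅ c ⁆ ∪ ⁅ d ⁆))       ≡⟨ sym (∪-assoc ⁅ a ⁆ ⁅ b ⁆ (doubleton c d)) ⟩
  doubleton a b ∪ doubleton c d           ∎
  where open ≡-Reasoning

-- Opaque: these witnesses are only used through their types, and unfolding the proofs while type
-- checking their users is prohibitively slow.
opaque
  ∣p∣≡1⇒singleton : ∣ p ∣ ≡ 1 → ∃ λ a → p ≡ ⁅ a ⁆
  ∣p∣≡1⇒singleton ∣p∣≡1 with ∣p∣≡1+k⇒Nonempty ∣p∣≡1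
  ... | a , a∈p = a , sym (p⊆q∧∣q∣≤∣p∣⇒p≡q (x∈p⇒⁅x⁆⊆p a∈p) (≤-reflexive (trans ∣p∣≡1 (sym (∣⁅x⁆∣≡1 a)))))

  remove-element : ∀ {n k} {p : Subset n} → ∣ p ∣ ≡ suc k → ∃ λ a → p ≡ ⁅ a ⁆ ∪ (p - a) × ∣ p - a ∣ ≡ k
  remove-element ∣p∣≡1+k with ∣p∣≡1+k⇒Nonempty ∣p∣≡1+k
  ... | a , a∈p = a , p⊆q⇒q≡p∪q─p (x∈p⇒⁅x⁆⊆p a∈p) ,
                  trans (∣q─p∣ (x∈p⇒⁅x⁆⊆p a∈p)) (cong₂ _∸_ ∣p∣≡1+k (∣⁅x⁆∣≡1 a))

  ∣p∣≡2⇒doubleton : ∣ p ∣ ≡ 2 → ∃₂ λ a b → a ≢ b × p ≡ doubleton a b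
  ∣p∣≡2⇒doubleton ∣p∣≡2 =
    let a , p≡a∪r , ∣r∣≡1 = remove-element ∣p∣≡2
        b , r≡b = ∣p∣≡1⇒singleton ∣r∣≡1
    in a , b , (λ a≡b → x∈p-y⇒x≢y (subst (b ∈ₛ_) (sym r≡b) (x∈⁅x⁆ b)) (sym a≡b)) ,
       trans p≡a∪r (cong (⁅ a ⁆ ∪_) r≡b)

  ∣p∣≡3⇒triple : ∣ p ∣ ≡ 3 → ∃₂ λ a b → ∃ λ c → Distinct₃ a b c × p ≡ doubleton a b ∪ ⁅ c ⁆
  ∣p∣≡3⇒triple ∣p∣≡3 =
    let a , p≡a∪r , ∣r∣≡2 = remove-element ∣p∣≡3
        b , c , b≢c , r≡bc = ∣p∣≡2⇒doubleton ∣r∣≡2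
        a≢ : ∀ {x} → x ∈ₛ doubleton b c → a ≢ x
        a≢ x∈bc a≡x = x∈p-y⇒x≢y (subst (_ ∈ₛ_) (sym r≡bc) x∈bc) (sym a≡x)
    in a , b , c , (a≢ (∈-doubletonˡ b c) , a≢ (∈-doubletonʳ b c) , b≢c) ,
       trans p≡a∪r (trans (cong (⁅ a ⁆ ∪_) r≡bc) (sym (∪-assoc ⁅ a ⁆ ⁅ b ⁆ ⁅ c ⁆)))

  ∣p∣≡4⇒quadruple : ∣ p ∣ ≡ 4 →
    ∃₂ λ a b → ∃₂ λ c d → Distinct₄ a b c d × p ≡ doubleton a b ∪ doubleton c d
  ∣p∣≡4⇒quadruple ∣p∣≡4 =
    let a , p≡a∪r , ∣r∣≡3 = remove-element ∣p∣≡4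
        b , c , d , (b≢c , b≢d , c≢d) , r≡bcd = ∣p∣≡3⇒triple ∣r∣≡3
        a≢ : ∀ {x} → x ∈ₛ doubleton b c ∪ ⁅ d ⁆ → a ≢ x
        a≢ x∈bcd a≡x = x∈p-y⇒x≢y (subst (_ ∈ₛ_) (sym r≡bcd) x∈bcd) (sym a≡x)
        b∈ , c∈ , d∈ = ∈-triple b c d
    in a , b , c , d , (a≢ b∈ , a≢ c∈ , a≢ d∈ , b≢c , b≢d , c≢d) ,
       trans p≡a∪r (trans (cong (⁅ a ⁆ ∪_) r≡bcd) (⁅a⁆∪[bc∪d] a b c d))

∉-doubleton-≡ : p ≡ doubleton a b → x ≢ a → x ≢ b → x ∉ₛ p
∉-doubleton-≡ refl = ∉-doubleton

∈-quadruple : ∀ (a b c d : Fin n) → let T = doubleton a b ∪ doubleton c d in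
              a ∈ₛ T × b ∈ₛ T × c ∈ₛ T × d ∈ₛ T
∈-quadruple a b c d =
  p⊆p∪q (doubleton c d) (∈-doubletonˡ a b) , p⊆p∪q (doubleton c d) (∈-doubletonʳ a b) ,
  q⊆p∪q (doubleton a b) (doubleton c d) (∈-doubletonˡ c d) ,
  q⊆p∪q (doubleton a b) (doubleton c d) (∈-doubletonʳ c d)

x∉p⇒x∈q : p ∪ q ≡ r → x ∈ₛ r → x ∉ₛ p → x ∈ₛ q
x∉p⇒x∈q {p = p} {q} refl x∈p∪q x∉p with x∈p∪q⁻ p q x∈p∪q
... | inj₁ x∈p = contradiction x∈p x∉p
... | inj₂ x∈q = x∈q

partition-pairingˡ : Distinct₄ a b c d → p ∪ q ≡ doubleton a b ∪ doubleton c d →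
                     ∣ p ∣ ≡ 2 → ∣ q ∣ ≡ 2 → a ∈ₛ p →
                     (p ≡ doubleton a b × q ≡ doubleton c d) ⊎
                     (p ≡ doubleton a c × q ≡ doubleton b d) ⊎
                     (p ≡ doubleton a d × q ≡ doubleton b c)
partition-pairingˡ {a = a} {b} {c} {d} {p} {q} (a≢b , a≢c , a≢d , b≢c , b≢d , c≢d) p∪q≡T ∣p∣≡2 ∣q∣≡2 a∈p
  with ∈-quadruple a b c d | b ∈? p | c ∈? p
... | _ , _ , c∈T , d∈T | yes b∈p | _ =
  inj₁ (p≡ab , doubleton-unique c≢d (x∉p⇒x∈q p∪q≡T c∈T c∉p) (x∉p⇒x∈q p∪q≡T d∈T d∉p) ∣q∣≡2)
  where
  p≡ab = doubleton-unique a≢b a∈p b∈p ∣p∣≡2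
  c∉p = ∉-doubleton-≡ p≡ab (≢-sym a≢c) (≢-sym b≢c)
  d∉p = ∉-doubleton-≡ p≡ab (≢-sym a≢d) (≢-sym b≢d)
... | _ , b∈T , _ , d∈T | no b∉p | yes c∈p =
  inj₂ (inj₁ (p≡ac , doubleton-unique b≢d (x∉p⇒x∈q p∪q≡T b∈T b∉p) (x∉p⇒x∈q p∪q≡T d∈T d∉p) ∣q∣≡2))
  where
  p≡ac = doubleton-unique a≢c a∈p c∈p ∣p∣≡2
  d∉p = ∉-doubleton-≡ p≡ac (≢-sym a≢d) (≢-sym c≢d)
... | _ , b∈T , c∈T , d∈T | no b∉p | no c∉p =
  inj₂ (inj₂ (doubleton-unique a≢d a∈p d∈p ∣p∣≡2 , q≡bc))
  where
  q≡bc = doubleton-unique b≢c (x∉p⇒x∈q p∪q≡T b∈T b∉p) (x∉p⇒x∈q p∪q≡T c∈T c∉p) ∣q∣≡2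
  d∉q = ∉-doubleton-≡ q≡bc (≢-sym b≢d) (≢-sym c≢d)
  d∈p = x∉p⇒x∈q (trans (∪-comm q p) p∪q≡T) d∈T d∉q

PartitionIs : Subset n → Subset n → Subset n → Subset n → Set
PartitionIs p q X Y = (p ≡ X × q ≡ Y) ⊎ (p ≡ Y × q ≡ X)

Pairing : Subset n → Subset n → Fin n → Fin n → Fin n → Fin n → Set
Pairing p q a b c d = PartitionIs p q (doubleton a b) (doubleton c d)
                    ⊎ PartitionIs p q (doubleton a c) (doubleton b d)
                    ⊎ PartitionIs p q (doubleton a d) (doubleton b c)

partition-pairing : Distinct₄ a b c d → p ∪ q ≡ doubleton a b ∪ doubleton c d →
                    ∣ p ∣ ≡ 2 → ∣ q ∣ ≡ 2 → Pairing p q a b c d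
partition-pairing {a = a} {b} {c} {d} {p} {q} distinct p∪q≡T ∣p∣≡2 ∣q∣≡2
  with x∈p∪q⁻ p q (subst (a ∈ₛ_) (sym p∪q≡T) (proj₁ (∈-quadruple a b c d)))
... | inj₁ a∈p with partition-pairingˡ distinct p∪q≡T ∣p∣≡2 ∣q∣≡2 a∈p
...   | inj₁ p,q≡ab,cd        = inj₁ (inj₁ p,q≡ab,cd)
...   | inj₂ (inj₁ p,q≡ac,bd) = inj₂ (inj₁ (inj₁ p,q≡ac,bd))
...   | inj₂ (inj₂ p,q≡ad,bc) = inj₂ (inj₂ (inj₁ p,q≡ad,bc))
partition-pairing {p = p} {q} distinct p∪q≡T ∣p∣≡2 ∣q∣≡2 | inj₂ a∈q
  with partition-pairingˡ distinct (trans (∪-comm q p) p∪q≡T) ∣q∣≡2 ∣p∣≡2 a∈q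
...   | inj₁ (q≡ab , p≡cd)        = inj₁ (inj₂ (p≡cd , q≡ab))
...   | inj₂ (inj₁ (q≡ac , p≡bd)) = inj₂ (inj₁ (inj₂ (p≡bd , q≡ac)))
...   | inj₂ (inj₂ (q≡ad , p≡bc)) = inj₂ (inj₂ (inj₂ (p≡bc , q≡ad)))

Disjoint-doubletons : a ≢ c → a ≢ d → b ≢ c → b ≢ d → Disjoint (doubleton a b) (doubleton c d)
Disjoint-doubletons {a = a} {c = c} {d = d} {b = b} a≢c a≢d b≢c b≢d = disjoint ∉cd
  where
  ∉cd : x ∈ₛ doubleton a b → x ∉ₛ doubleton c d
  ∉cd x∈ab with ∈-doubleton⁻ x∈ab
  ... | inj₁ refl = ∉-doubleton a≢c a≢d
  ... | inj₂ refl = ∉-doubleton b≢c b≢d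

_≟ₛ_ : DecidableEquality (Subset n)
_≟ₛ_ = ≡-dec Bool._≟_

module _ {n : ℕ} where
  open CommutativeSemigroupProperties (CommutativeMonoid.commutativeSemigroup (∪-commutativeMonoid n))
    using (interchange)

  ab∪cd≡ac∪bd : ∀ (a b c d : Fin n) → doubleton a b ∪ doubleton c d ≡ doubleton a c ∪ doubleton b d
  ab∪cd≡ac∪bd a b c d = interchange ⁅ a ⁆ ⁅ b ⁆ ⁅ c ⁆ ⁅ d ⁆

  ab∪cd≡ad∪bc : ∀ (a b c d : Fin n) → doubleton a b ∪ doubleton c d ≡ doubleton a d ∪ doubleton b c
  ab∪cd≡ad∪bc a b c d =
    trans (cong (doubleton a b ∪_) (∪-comm ⁅ c ⁆ ⁅ d ⁆)) (interchange ⁅ a ⁆ ⁅ b ⁆ ⁅ d ⁆ ⁅ c ⁆)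

∣p∩q∣<∣p∣ : ∣ p ∣ ≡ ∣ q ∣ → p ≢ q → ∣ p ∩ q ∣ < ∣ p ∣
∣p∩q∣<∣p∣ {p = p} {q} ∣p∣≡∣q∣ p≢q with ∣ p ∣ ℕ.≤? ∣ p ∩ q ∣
... | no  ∣p∣≰∣p∩q∣ = ℕ.≰⇒> ∣p∣≰∣p∩q∣
... | yes ∣p∣≤∣p∩q∣ = contradiction (trans (sym p∩q≡p) p∩q≡q) p≢q
  where
  p∩q≡p = p⊆q∧∣q∣≤∣p∣⇒p≡q (p∩q⊆p p q) ∣p∣≤∣p∩q∣
  p∩q≡q = p⊆q∧∣q∣≤∣p∣⇒p≡q (p∩q⊆q p q) (subst (_≤ ∣ p ∩ q ∣) ∣p∣≡∣q∣ ∣p∣≤∣p∩q∣)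

p⊆q⇒q∩p≡p : p ⊆ q → q ∩ p ≡ p
p⊆q⇒q∩p≡p {p = p} {q} p⊆q = ⊆-antisym (p∩q⊆q q p) (λ x∈p → x∈p∩q⁺ (p⊆q x∈p , x∈p))

-- Circuits

i+j≡3⇒j≡2 : ∀ {i j} → i + j ≡ 3 → 0 < i → 0 < j → i ≢ 2 → j ≡ 2
i+j≡3⇒j≡2 {zero}                    _    () _  _
i+j≡3⇒j≡2 {1}                       refl _  _  _   = refl
i+j≡3⇒j≡2 {2}                       _    _  _  i≢2 = contradiction refl i≢2
i+j≡3⇒j≡2 {3}                       refl _  () _
i+j≡3⇒j≡2 {suc (suc (suc (suc _)))} ()

i+j≡4⇒i≡j≡2⊎i≡3⊎j≡3 : ∀ {i j} → i + j ≡ 4 → 0 < i → 0 < j → (i ≡ 2 × j ≡ 2) ⊎ i ≡ 3 ⊎ j ≡ 3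
i+j≡4⇒i≡j≡2⊎i≡3⊎j≡3 {zero}                          _    () _
i+j≡4⇒i≡j≡2⊎i≡3⊎j≡3 {1}                             refl _  _  = inj₂ (inj₂ refl)
i+j≡4⇒i≡j≡2⊎i≡3⊎j≡3 {2}                             refl _  _  = inj₁ (refl , refl)
i+j≡4⇒i≡j≡2⊎i≡3⊎j≡3 {3}                             refl _  _  = inj₂ (inj₁ refl)
i+j≡4⇒i≡j≡2⊎i≡3⊎j≡3 {4}                             refl _  ()
i+j≡4⇒i≡j≡2⊎i≡3⊎j≡3 {suc (suc (suc (suc (suc _))))} ()

module _ {n : ℕ} where

  private variable
    gs xs : List (Subset n)
    s u w : Subset n

  Split : List (Subset n) → Subset n → Subset n → Subset n → Set
  Split gs s u w = Available gs u × Available gs w × Disjoint u w × s ≡ u ∪ w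

  Splittable : List (Subset n) → Subset n → Set
  Splittable gs s = ∃₂ (Split gs s)

  Available-++⁺ : ∀ xs → Available gs u → Available (xs ++ gs) u
  Available-++⁺ xs (inj₁ singleton) = inj₁ singleton
  Available-++⁺ xs (inj₂ u∈gs)      = inj₂ (∈-++⁺ʳ xs u∈gs)

  Split-++⁺ : ∀ xs → Split gs s u w → Split (xs ++ gs) s u w
  Split-++⁺ xs (u↓ , w↓ , u∩w=∅ , s≡u∪w) = Available-++⁺ xs u↓ , Available-++⁺ xs w↓ , u∩w=∅ , s≡u∪w

  stack : All (Splittable gs) xs → IsCircuit gs → IsCircuit (xs ++ gs)
  stack {xs = []}     []                                    circuit = circuit
  stack {xs = x ∷ xs} ((u , w , split) ∷ splittable) circuit =
    let u↓ , w↓ , u∩w=∅ , x≡u∪w = Split-++⁺ xs split in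
    addGate u w u↓ w↓ u∩w=∅ x≡u∪w (stack splittable circuit)

  gateSplits : IsCircuit gs → List (Subset n × Subset n × Subset n)
  gateSplits noGates                             = []
  gateSplits (addGate {s = s} u w _ _ _ _ circuit) = (s , u , w) ∷ gateSplits circuit

  length-gateSplits : (circuit : IsCircuit gs) → length (gateSplits circuit) ≡ length gs
  length-gateSplits noGates                         = refl
  length-gateSplits (addGate _ _ _ _ _ _ circuit) = cong suc (length-gateSplits circuit)

  gateSplit : (circuit : IsCircuit gs) → s ∈ gs →
              ∃₂ λ u w → (s , u , w) ∈ gateSplits circuit × Split gs s u w
  gateSplit (addGate u w u↓ w↓ u∩w=∅ s≡u∪w circuit) (here refl) =
    u , w , here refl , Split-++⁺ (_ ∷ []) (u↓ , w↓ , u∩w=∅ , s≡u∪w)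
  gateSplit (addGate _ _ _ _ _ _ circuit) (there s∈gs) =
    let u , w , r∈ , split = gateSplit circuit s∈gs in
    u , w , there r∈ , Split-++⁺ (_ ∷ []) split

  0<∣available∣ : All (λ g → 0 < ∣ g ∣) gs → Available gs u → 0 < ∣ u ∣
  0<∣available∣ _   (inj₁ (i , refl)) = ≤-reflexive (sym (∣⁅x⁆∣≡1 i))
  0<∣available∣ gs⁺ (inj₂ u∈gs)      = All.lookup gs⁺ u∈gs

  0<∣gate∣ : IsCircuit gs → All (λ g → 0 < ∣ g ∣) gs
  0<∣gate∣ noGates                               = []
  0<∣gate∣ (addGate u w u↓ _ _ refl circuit) =
    ≤-trans (0<∣available∣ (0<∣gate∣ circuit) u↓) (∣p∣≤∣p∪q∣ u w) ∷ 0<∣gate∣ circuit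

  available-nonempty : IsCircuit gs → Available gs u → 0 < ∣ u ∣
  available-nonempty circuit = 0<∣available∣ (0<∣gate∣ circuit)

  available-gate : Available gs u → 2 ≤ ∣ u ∣ → u ∈ gs
  available-gate (inj₁ (i , refl)) 2≤∣⁅i⁆∣ with ≤-trans 2≤∣⁅i⁆∣ (≤-reflexive (∣⁅x⁆∣≡1 i))
  ... | s≤s ()
  available-gate (inj₂ u∈gs) _ = u∈gs

  Split-comm : Split gs s u w → Split gs s w u
  Split-comm {u = u} {w} (u↓ , w↓ , u∩w=∅ , s≡u∪w) = w↓ , u↓ , Disjoint-sym u∩w=∅ , trans s≡u∪w (∪-comm u w)

  ∣split∣ : Split gs s u w → ∣ s ∣ ≡ ∣ u ∣ + ∣ w ∣
  ∣split∣ {u = u} {w} (_ , _ , u∩w=∅ , refl) = ∣p∪q∣≡∣p∣+∣q∣ u w u∩w=∅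

  Split-⊆ˡ : Split gs s u w → u ⊆ s
  Split-⊆ˡ {w = w} (_ , _ , _ , refl) = p⊆p∪q w

  Split-off : Available gs u → u ⊆ s → ∣ s ∣ ≡ suc ∣ u ∣ → Splittable gs s
  Split-off {u = u} {s} u↓ u⊆s ∣s∣≡1+∣u∣ =
    let ∣s─u∣≡1 = trans (∣q─p∣ u⊆s) (trans (cong (_∸ ∣ u ∣) ∣s∣≡1+∣u∣) (m+n∸n≡m 1 ∣ u ∣))
        x , s─u≡x = ∣p∣≡1⇒singleton ∣s─u∣≡1
    in u , ⁅ x ⁆ , u↓ , inj₁ (x , refl) , subst (Disjoint u) s─u≡x (Disjoint-─ u s) ,
       trans (p⊆q⇒q≡p∪q─p u⊆s) (cong (u ∪_) s─u≡x)

  twoPart : Subset n → Subset n → Subset n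
  twoPart u w with ∣ u ∣ ≟ 2
  ... | yes _ = u
  ... | no  _ = w

  twoPart-gate : IsCircuit gs → Split gs s u w → ∣ s ∣ ≡ 3 →
                 twoPart u w ∈ gs × twoPart u w ⊆ s × ∣ twoPart u w ∣ ≡ 2
  twoPart-gate {u = u} {w} circuit split@(u↓ , w↓ , _) ∣s∣≡3 with ∣ u ∣ ≟ 2
  ... | yes ∣u∣≡2 = available-gate u↓ (≤-reflexive (sym ∣u∣≡2)) , Split-⊆ˡ split , ∣u∣≡2
  ... | no  ∣u∣≢2 =
    available-gate w↓ (≤-reflexive (sym ∣w∣≡2)) , Split-⊆ˡ (Split-comm split) , ∣w∣≡2
    where
    ∣w∣≡2 = i+j≡3⇒j≡2 (trans (sym (∣split∣ split)) ∣s∣≡3)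
              (available-nonempty circuit u↓) (available-nonempty circuit w↓) ∣u∣≢2

module Hypergraph {n : ℕ} (𝒯 : List (Subset n)) (Bfin : Family n) (M : List (Subset n × Subset n)) where

  private variable
    C : List (Subset n)
    T P Q X Y : Subset n

  PairIn : List (Subset n) → Subset n → Set
  PairIn C T = ∃ λ P → P ∈ C × P ⊆ T

  PartitionIn : List (Subset n) → Subset n → Set
  PartitionIn C T = ∃₂ λ P Q → P ∈ C × Q ∈ C × Disjoint P Q × T ≡ P ∪ Q

  record Serves (C : List (Subset n)) : Set where
    field
      doubletons : Tsize 𝒯 2 T → T ∈ C
      triples    : T3' 𝒯 M T → PairIn C T
      quadruples : Depth2 𝒯 Bfin M T → PartitionIn C T

  Covers : List (Subset n) → Set
  Covers C = ∀ E → HEdge 𝒯 Bfin M E → Any (_∈ C) E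

  T3'-size : IsMatching 𝒯 Bfin M → T3' 𝒯 M T → ∣ T ∣ ≡ 3
  T3'-size _           (inj₁ (_ , ∣T∣≡3))      = ∣T∣≡3
  T3'-size (edges , _) (inj₂ (e , e∈M , refl)) = proj₂ (proj₂ (All.lookup edges e∈M))

  pick-∈ : X ∈ C × Y ∈ C → ∀ β → pick 𝒯 β X Y ∈ C
  pick-∈ (X∈C , _) true  = X∈C
  pick-∈ (_ , Y∈C) false = Y∈C

  PartitionIs-∈ : PartitionIs P Q X Y → P ∈ C → Q ∈ C → X ∈ C × Y ∈ C
  PartitionIs-∈ (inj₁ (refl , refl)) P∈C Q∈C = P∈C , Q∈C
  PartitionIs-∈ (inj₂ (refl , refl)) P∈C Q∈C = Q∈C , P∈C

  quadrupleEdge : Fin n → Fin n → Fin n → Fin n → Bool → Bool → Bool → List (Subset n)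
  quadrupleEdge a b c d β₁ β₂ β₃ =
    pick 𝒯 β₁ (doubleton a b) (doubleton c d) ∷ pick 𝒯 β₂ (doubleton a c) (doubleton b d) ∷
    pick 𝒯 β₃ (doubleton a d) (doubleton b c) ∷ []

  pairing-hits : ∀ {a b c d} → Pairing P Q a b c d → P ∈ C → Q ∈ C →
                 ∀ β₁ β₂ β₃ → Any (_∈ C) (quadrupleEdge a b c d β₁ β₂ β₃)
  pairing-hits (inj₁ partition) P∈C Q∈C β₁ _ _ =
    here (pick-∈ (PartitionIs-∈ partition P∈C Q∈C) β₁)
  pairing-hits (inj₂ (inj₁ partition)) P∈C Q∈C _ β₂ _ =
    there (here (pick-∈ (PartitionIs-∈ partition P∈C Q∈C) β₂))
  pairing-hits (inj₂ (inj₂ partition)) P∈C Q∈C _ _ β₃ =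
    there (there (here (pick-∈ (PartitionIs-∈ partition P∈C Q∈C) β₃)))

  serves⇒covers : All (λ U → ∣ U ∣ ≡ 2) C → Serves C → Covers C
  serves⇒covers _ serves _ (edge2 T₂) = here (Serves.doubletons serves T₂)
  serves⇒covers sizes serves _ (edge3 a b c a≢b a≢c b≢c refl T₃′)
    with P , P∈C , P⊆T ← Serves.triples serves T₃′
    with doubleton⊆triple (a≢b , a≢c , b≢c) P⊆T (All.lookup sizes P∈C)
  ... | inj₁ refl        = here P∈C
  ... | inj₂ (inj₁ refl) = there (here P∈C)
  ... | inj₂ (inj₂ refl) = there (there (here P∈C))
  serves⇒covers sizes serves _ (edge4 a b c d a≢b a≢c a≢d b≢c b≢d c≢d refl T₄ β₁ β₂ β₃) =
    let P , Q , P∈C , Q∈C , _ , T≡P∪Q = Serves.quadruples serves T₄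
    in pairing-hits (partition-pairing (a≢b , a≢c , a≢d , b≢c , b≢d , c≢d) (sym T≡P∪Q)
                                       (All.lookup sizes P∈C) (All.lookup sizes Q∈C))
                    P∈C Q∈C β₁ β₂ β₃

  both-or-missing : ∀ X Y → (X ∈ C × Y ∈ C) ⊎ ∃ λ β → pick 𝒯 β X Y ∉ C
  both-or-missing {C = C} X Y with ∈?[ _≟ₛ_ ] X C | ∈?[ _≟ₛ_ ] Y C
  ... | yes X∈C | yes Y∈C = inj₁ (X∈C , Y∈C)
  ... | no  X∉C | _       = inj₂ (true , X∉C)
  ... | yes _   | no  Y∉C = inj₂ (false , Y∉C)

  covered-pairing : ∀ {X₁ Y₁ X₂ Y₂ X₃ Y₃} →
    (∀ β₁ β₂ β₃ → Any (_∈ C) (pick 𝒯 β₁ X₁ Y₁ ∷ pick 𝒯 β₂ X₂ Y₂ ∷ pick 𝒯 β₃ X₃ Y₃ ∷ [])) →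
    (X₁ ∈ C × Y₁ ∈ C) ⊎ (X₂ ∈ C × Y₂ ∈ C) ⊎ (X₃ ∈ C × Y₃ ∈ C)
  covered-pairing {X₁ = X₁} {Y₁} {X₂} {Y₂} {X₃} {Y₃} hits
    with both-or-missing X₁ Y₁ | both-or-missing X₂ Y₂ | both-or-missing X₃ Y₃
  ... | inj₁ both | _         | _         = inj₁ both
  ... | inj₂ _    | inj₁ both | _         = inj₂ (inj₁ both)
  ... | inj₂ _    | inj₂ _    | inj₁ both = inj₂ (inj₂ both)
  ... | inj₂ (β₁ , miss₁) | inj₂ (β₂ , miss₂) | inj₂ (β₃ , miss₃) with hits β₁ β₂ β₃
  ...   | here hit                 = contradiction hit miss₁
  ...   | there (here hit)         = contradiction hit miss₂
  ...   | there (there (here hit)) = contradiction hit miss₃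

  pairing⇒partition : ∀ {a b c d} → Distinct₄ a b c d →
    (doubleton a b ∈ C × doubleton c d ∈ C) ⊎ (doubleton a c ∈ C × doubleton b d ∈ C) ⊎
    (doubleton a d ∈ C × doubleton b c ∈ C) → PartitionIn C (doubleton a b ∪ doubleton c d)
  pairing⇒partition {a = a} {b = b} {c = c} {d = d} (a≢b , a≢c , a≢d , b≢c , b≢d , c≢d) pairing
    with pairing
  ... | inj₁ (ab∈C , cd∈C) =
    doubleton a b , doubleton c d , ab∈C , cd∈C , Disjoint-doubletons a≢c a≢d b≢c b≢d , refl
  ... | inj₂ (inj₁ (ac∈C , bd∈C)) =
    doubleton a c , doubleton b d , ac∈C , bd∈C , Disjoint-doubletons a≢b a≢d (≢-sym b≢c) c≢d ,
    ab∪cd≡ac∪bd a b c d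
  ... | inj₂ (inj₂ (ad∈C , bc∈C)) =
    doubleton a d , doubleton b c , ad∈C , bc∈C , Disjoint-doubletons a≢b a≢c (≢-sym b≢d) (≢-sym c≢d) ,
    ab∪cd≡ad∪bc a b c d

  covers⇒serves : IsMatching 𝒯 Bfin M → Covers C → Serves C
  covers⇒serves {C = C} matching covers = record
    { doubletons = doubletons ; triples = triples ; quadruples = quadruples }
    where
    doubletons : Tsize 𝒯 2 T → T ∈ C
    doubletons T₂ with covers _ (edge2 T₂)
    ... | here T∈C = T∈C

    triples : T3' 𝒯 M T → PairIn C T
    triples {T = T} T₃′ with ∣p∣≡3⇒triple {p = T} (T3'-size matching T₃′)
    ... | a , b , c , (a≢b , a≢c , b≢c) , refl
      with a∈ , b∈ , c∈ ← ∈-triple a b c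
      with covers _ (edge3 a b c a≢b a≢c b≢c refl T₃′)
    ...   | here ab∈C                 = _ , ab∈C , doubleton⊆ a∈ b∈
    ...   | there (here ac∈C)         = _ , ac∈C , doubleton⊆ a∈ c∈
    ...   | there (there (here bc∈C)) = _ , bc∈C , doubleton⊆ b∈ c∈

    quadruples : Depth2 𝒯 Bfin M T → PartitionIn C T
    quadruples {T = T} T₄ =
      let a , b , c , d , distinct@(a≢b , a≢c , a≢d , b≢c , b≢d , c≢d) , T≡abcd =
            ∣p∣≡4⇒quadruple {p = T} (proj₂ (proj₁ T₄))
      in subst (PartitionIn C) (sym T≡abcd) (pairing⇒partition distinct (covered-pairing λ β₁ β₂ β₃ →
           covers _ (edge4 a b c d a≢b a≢c a≢d b≢c b≢d c≢d T≡abcd T₄ β₁ β₂ β₃)))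

module Depth2Trees {n : ℕ} (𝒯 : List (Subset n)) (Bfin : Family n) (M : List (Subset n × Subset n)) where

  private variable
    B B′ : Family n
    T T′ Y : Subset n

  final-no-group : IntersectRun 𝒯 B B′ → ¬ ∃ (Group 𝒯 B′)
  final-no-group (done no-group)  = no-group
  final-no-group (step _ _ run) = final-no-group run

  Depth2⇒GVert : Depth2 𝒯 Bfin M T → GVert 𝒯 Bfin T
  Depth2⇒GVert (T₄ , ¬sup3 , ¬inter , _) = T₄ , ¬sup3 , ¬inter

  GVert⇒∉Bfin : GVert 𝒯 Bfin T → ¬ Bfin T
  GVert⇒∉Bfin (_ , ¬sup3 , ¬inter) T∈Bfin = ¬inter (T∈Bfin , ¬sup3)

  4≢3 : ∀ {i} → i ≡ 4 → i ≢ 3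
  4≢3 refl ()

  uncovered-disjoint : Depth2 𝒯 Bfin M T → Depth2 𝒯 Bfin M T′ → All (EdgesDisjoint 𝒯 (T , T′)) M
  uncovered-disjoint (_ , _ , _ , T∉M) (_ , _ , _ , T′∉M) = All.tabulate λ e∈M →
    (λ T≡ → T∉M (_ , e∈M , inj₁ (sym T≡))) , (λ T≡ → T∉M (_ , e∈M , inj₂ (sym T≡))) ,
    (λ T′≡ → T′∉M (_ , e∈M , inj₁ (sym T′≡))) , (λ T′≡ → T′∉M (_ , e∈M , inj₂ (sym T′≡)))

  Depth2-above-unique : IsMaxMatching 𝒯 Bfin M → Depth2 𝒯 Bfin M T → Depth2 𝒯 Bfin M T′ →
                        Y ⊆ T → Y ⊆ T′ → ∣ Y ∣ ≡ 3 → T ≡ T′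
  Depth2-above-unique {T = T} {T′} {Y} ((edges , pairwise-disjoint) , maximum) T₄ T′₄ Y⊆T Y⊆T′ ∣Y∣≡3 with T ≟ₛ T′
  ... | yes T≡T′ = T≡T′
  ... | no  T≢T′ = contradiction (maximum _ larger) (<-irrefl refl)
    where
    ∣T∩T′∣≡3 : ∣ T ∩ T′ ∣ ≡ 3
    ∣T∣≡4 = proj₂ (proj₁ T₄)
    ∣T∩T′∣≡3 = ≤-antisym
      (≤-pred (subst (∣ T ∩ T′ ∣ <_) ∣T∣≡4 (∣p∩q∣<∣p∣ (trans ∣T∣≡4 (sym (proj₂ (proj₁ T′₄)))) T≢T′)))
      (subst (_≤ ∣ T ∩ T′ ∣) ∣Y∣≡3 (p⊆q⇒∣p∣≤∣q∣ λ y∈Y → x∈p∩q⁺ (Y⊆T y∈Y , Y⊆T′ y∈Y)))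
    larger : IsMatching 𝒯 Bfin ((T , T′) ∷ M)
    larger = (Depth2⇒GVert T₄ , Depth2⇒GVert T′₄ , ∣T∩T′∣≡3) ∷ edges , uncovered-disjoint T₄ T′₄ ∷ pairwise-disjoint

  T3'-not-below-Depth2 : IntersectRun 𝒯 (Sup3 𝒯) Bfin → IsMatching 𝒯 Bfin M →
                         T3' 𝒯 M Y → Depth2 𝒯 Bfin M T → ¬ Y ⊆ T
  T3'-not-below-Depth2 _ _ (inj₁ Y₃@(_ , ∣Y∣≡3)) (T₄@(_ , ∣T∣≡4) , ¬sup3 , _) Y⊆T =
    ¬sup3 (T₄ , _ , Y₃ , Y⊆T , λ Y≡T → 4≢3 ∣T∣≡4 (trans (cong ∣_∣ (sym Y≡T)) ∣Y∣≡3))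
  T3'-not-below-Depth2 {T = T} run (edges , _) (inj₂ ((T₁ , T₂) , e∈M , refl)) T₄@(_ , _ , _ , T∉M) Y⊆T =
    final-no-group run (T ∷ T₁ ∷ T₂ ∷ [] , s≤s (s≤s (s≤s z≤n)) , distinct , members , ∣⋂∣≡3)
    where
    G₁ = proj₁ (All.lookup edges e∈M)
    G₂ = proj₁ (proj₂ (All.lookup edges e∈M))
    ∣T₁∩T₂∣≡3 = proj₂ (proj₂ (All.lookup edges e∈M))
    T₁≢T₂ : T₁ ≢ T₂
    T₁≢T₂ refl = 4≢3 (proj₂ (proj₁ G₁)) (trans (cong ∣_∣ (sym (∩-idem T₁))) ∣T₁∩T₂∣≡3)
    distinct : Unique (T ∷ T₁ ∷ T₂ ∷ [])
    distinct = ((λ T≡T₁ → T∉M (_ , e∈M , inj₁ (sym T≡T₁))) ∷ (λ T≡T₂ → T∉M (_ , e∈M , inj₂ (sym T≡T₂))) ∷ [])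
             ∷ (T₁≢T₂ ∷ [])
             ∷ []
             ∷ []
    members : All (λ X → Tsize 𝒯 4 X × ¬ Bfin X) (T ∷ T₁ ∷ T₂ ∷ [])
    members = member (Depth2⇒GVert T₄) ∷ member G₁ ∷ member G₂ ∷ []
      where member = λ {X} (G : GVert 𝒯 Bfin X) → proj₁ G , GVert⇒∉Bfin G
    ∣⋂∣≡3 : ∣ T ∩ (T₁ ∩ (T₂ ∩ ⊤)) ∣ ≡ 3
    ∣⋂∣≡3 rewrite ∩-identityʳ T₂ | p⊆q⇒q∩p≡p Y⊆T = ∣T₁∩T₂∣≡3

module Bounds {n : ℕ} (𝒯 : List (Subset n)) (Bfin : Family n) (run : IntersectRun 𝒯 (Sup3 𝒯) Bfin)
              (M : List (Subset n × Subset n)) (maximum : IsMaxMatching 𝒯 Bfin M)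
              (L : List (Subset n)) (L! : Unique L)
              (L⇔ : ∀ T → (T ∈ L) ⇔ (T3' 𝒯 M T ⊎ Depth2 𝒯 Bfin M T)) where

  open Hypergraph 𝒯 Bfin M
  open Depth2Trees 𝒯 Bfin M

  private variable
    T U : Subset n

  matching : IsMatching 𝒯 Bfin M
  matching = proj₁ maximum

  L⁻ : T ∈ L → T3' 𝒯 M T ⊎ Depth2 𝒯 Bfin M T
  L⁻ {T} = Equivalence.to (L⇔ T)

  L⁺ : T3' 𝒯 M T ⊎ Depth2 𝒯 Bfin M T → T ∈ L
  L⁺ {T} = Equivalence.from (L⇔ T)

  cover⇒solution : ∀ {C} → IsVC 𝒯 Bfin M C → IsSolution (DepthLe2 𝒯 Bfin M) (L ++ C)
  cover⇒solution {C} (vertices , covers) = circuit , available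
    where
    open Serves (covers⇒serves matching covers)

    sizes : All (λ U → ∣ U ∣ ≡ 2) C
    sizes = All.map (λ (_ , _ , _ , ∣U∣≡2) → ∣U∣≡2) vertices

    doubleton-splittable : ∣ U ∣ ≡ 2 → Splittable [] U
    doubleton-splittable ∣U∣≡2 =
      let a , b , a≢b , U≡ab = ∣p∣≡2⇒doubleton ∣U∣≡2
      in ⁅ a ⁆ , ⁅ b ⁆ , inj₁ (a , refl) , inj₁ (b , refl) , Disjoint-singletons a≢b , U≡ab

    tree-splittable : T ∈ L → Splittable C T
    tree-splittable T∈L with L⁻ T∈L
    ... | inj₁ T₃′ = let P , P∈C , P⊆T = triples T₃′ in
      Split-off (inj₂ P∈C) P⊆T (trans (T3'-size matching T₃′) (cong suc (sym (All.lookup sizes P∈C))))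
    ... | inj₂ T₄ = let P , Q , P∈C , Q∈C , P∩Q=∅ , T≡P∪Q = quadruples T₄ in
      P , Q , inj₂ P∈C , inj₂ Q∈C , P∩Q=∅ , T≡P∪Q

    circuit : IsCircuit (L ++ C)
    circuit = stack (All.tabulate tree-splittable)
                    (subst IsCircuit (++-identityʳ C) (stack (All.map doubleton-splittable sizes) noGates))

    available : ∀ T → DepthLe2 𝒯 Bfin M T → Available (L ++ C) T
    available T (inj₁ T₂)  = inj₂ (∈-++⁺ʳ L (doubletons T₂))
    available T (inj₂ T₃₄) = inj₂ (∈-++⁺ˡ (L⁺ T₃₄))

  2≤∣tree∣ : DepthLe2 𝒯 Bfin M T → 2 ≤ ∣ T ∣
  2≤∣tree∣ (inj₁ (_ , ∣T∣≡2))  = ≤-reflexive (sym ∣T∣≡2)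
  2≤∣tree∣ (inj₂ (inj₁ T₃′))   = subst (2 ≤_) (sym (T3'-size matching T₃′)) (s≤s (s≤s z≤n))
  2≤∣tree∣ (inj₂ (inj₂ T₄))    = subst (2 ≤_) (sym (proj₂ (proj₁ T₄))) (s≤s (s≤s z≤n))

  L-quadruple⇒Depth2 : T ∈ L → ∣ T ∣ ≡ 4 → Depth2 𝒯 Bfin M T
  L-quadruple⇒Depth2 T∈L ∣T∣≡4 with L⁻ T∈L
  ... | inj₁ T₃′ = contradiction (T3'-size matching T₃′) (4≢3 ∣T∣≡4)
  ... | inj₂ T₄  = T₄

  IsVertex : Subset n → Set
  IsVertex U = ∣ U ∣ ≡ 2 × (U ∈ 𝒯 ⊎ Any (U ⊆_) L)

  isVertex? : Decidable IsVertex
  isVertex? U = (∣ U ∣ ≟ 2) ×-dec (∈?[ _≟ₛ_ ] U 𝒯 ⊎-dec any? (U ⊆?_) L)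

  IsVertex⇒HVertex : IsVertex U → HVertex 𝒯 Bfin M U
  IsVertex⇒HVertex (∣U∣≡2 , inj₁ U∈𝒯) = _ , inj₁ (U∈𝒯 , ∣U∣≡2) , (λ x∈U → x∈U) , ∣U∣≡2
  IsVertex⇒HVertex (∣U∣≡2 , inj₂ U⊆L) = let T , T∈L , U⊆T = find U⊆L in T , inj₂ (L⁻ T∈L) , U⊆T , ∣U∣≡2

  ⊆L⇒IsVertex : T ∈ L → U ⊆ T → ∣ U ∣ ≡ 2 → IsVertex U
  ⊆L⇒IsVertex T∈L U⊆T ∣U∣≡2 = ∣U∣≡2 , inj₂ (lose T∈L U⊆T)

  QuadrupleAbove : Subset n → Subset n → Set
  QuadrupleAbove s T = ∣ T ∣ ≡ 4 × s ⊆ T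

  quadrupleAbove? : ∀ s → Decidable (QuadrupleAbove s)
  quadrupleAbove? s T = (∣ T ∣ ≟ 4) ×-dec (s ⊆? T)

  charge : Subset n × Subset n × Subset n → Maybe (Subset n)
  charge (s , u , w) with ∣ s ∣ ≟ 2 | ∣ s ∣ ≟ 3 | any? (quadrupleAbove? s) L
  ... | yes _ | _     | _         = just s
  ... | no _  | yes _ | yes above = just (proj₁ (find above) ─ twoPart u w)
  ... | no _  | yes _ | no _      = nothing
  ... | no _  | no _  | _         = nothing

  charge-doubleton : ∀ {s} u w → ∣ s ∣ ≡ 2 → charge (s , u , w) ≡ just s
  charge-doubleton {s} u w ∣s∣≡2 with ∣ s ∣ ≟ 2 | ∣ s ∣ ≟ 3 | any? (quadrupleAbove? s) L
  ... | yes _    | _ | _ = refl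
  ... | no ∣s∣≢2 | _ | _ = contradiction ∣s∣≡2 ∣s∣≢2

  charge-triple : ∀ {s} u w → ∣ s ∣ ≡ 3 → Depth2 𝒯 Bfin M T → s ⊆ T →
                  charge (s , u , w) ≡ just (T ─ twoPart u w)
  charge-triple {T = T} {s} u w ∣s∣≡3 T₄ s⊆T with ∣ s ∣ ≟ 2 | ∣ s ∣ ≟ 3 | any? (quadrupleAbove? s) L
  ... | yes ∣s∣≡2 | _        | _         = contradiction (trans (sym ∣s∣≡2) ∣s∣≡3) λ ()
  ... | no _      | no ∣s∣≢3 | _         = contradiction ∣s∣≡3 ∣s∣≢3
  ... | no _      | yes _    | no ∄above =
    contradiction (lose (L⁺ (inj₂ T₄)) (proj₂ (proj₁ T₄) , λ {_} → s⊆T)) ∄above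
  ... | no _      | yes _    | yes above =
    let T′ , T′∈L , ∣T′∣≡4 , s⊆T′ = find above in
    cong (λ X → just (X ─ twoPart u w))
         (Depth2-above-unique maximum (L-quadruple⇒Depth2 T′∈L ∣T′∣≡4) T₄ s⊆T′ s⊆T ∣s∣≡3)

  charge-L : ∀ {s} u w → s ∈ L → charge (s , u , w) ≡ nothing
  charge-L {s} u w s∈L with ∣ s ∣ ≟ 2 | ∣ s ∣ ≟ 3 | any? (quadrupleAbove? s) L | L⁻ s∈L
  ... | no _      | no _      | _         | _        = refl
  ... | no _      | yes _     | no _      | _        = refl
  ... | no _      | yes _     | yes above | inj₁ s₃′ =
    let T , T∈L , ∣T∣≡4 , s⊆T = find above in
    contradiction (λ {_} → s⊆T) (T3'-not-below-Depth2 run matching s₃′ (L-quadruple⇒Depth2 T∈L ∣T∣≡4))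
  ... | no _      | yes ∣s∣≡3 | yes _     | inj₂ s₄  = contradiction ∣s∣≡3 (4≢3 (proj₂ (proj₁ s₄)))
  ... | yes ∣s∣≡2 | _         | _         | inj₁ s₃′ =
    contradiction (trans (sym ∣s∣≡2) (T3'-size matching s₃′)) λ ()
  ... | yes ∣s∣≡2 | _         | _         | inj₂ s₄  =
    contradiction (trans (sym ∣s∣≡2) (proj₂ (proj₁ s₄))) λ ()

  module LowerBound {gs : List (Subset n)} (circuit : IsCircuit gs)
                    (available : ∀ T → DepthLe2 𝒯 Bfin M T → Available gs T) where

    tree-gate : DepthLe2 𝒯 Bfin M T → T ∈ gs
    tree-gate {T} T≤2 = available-gate (available T T≤2) (2≤∣tree∣ T≤2)

    splits : List (Subset n × Subset n × Subset n)
    splits = gateSplits circuit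

    charged : List (Subset n)
    charged = mapMaybe charge splits

    C : List (Subset n)
    C = deduplicate _≟ₛ_ (filter isVertex? charged)

    charged∈C : ∀ {r} → r ∈ splits → charge r ≡ just U → IsVertex U → U ∈ C
    charged∈C r∈ charge≡U U-vertex =
      ∈-deduplicate⁺ _≟ₛ_ (∈-filter⁺ isVertex? (∈-mapMaybe⁺ charge r∈ charge≡U) U-vertex)

    doubleton-gate∈C : U ∈ gs → ∣ U ∣ ≡ 2 → IsVertex U → U ∈ C
    doubleton-gate∈C U∈gs ∣U∣≡2 =
      let u , w , r∈ , _ = gateSplit circuit U∈gs in charged∈C r∈ (charge-doubleton u w ∣U∣≡2)

    tree-split : DepthLe2 𝒯 Bfin M T → ∃₂ λ u w → (T , u , w) ∈ splits × Split gs T u w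
    tree-split T≤2 = gateSplit circuit (tree-gate T≤2)

    available-doubleton∈C : Depth2 𝒯 Bfin M T → Available gs U → U ⊆ T → ∣ U ∣ ≡ 2 → U ∈ C
    available-doubleton∈C T₄ U↓ U⊆T ∣U∣≡2 =
      doubleton-gate∈C (available-gate U↓ (≤-reflexive (sym ∣U∣≡2))) ∣U∣≡2
                       (⊆L⇒IsVertex (L⁺ (inj₂ T₄)) U⊆T ∣U∣≡2)

    partition-via-triple : ∀ {Y d} → Depth2 𝒯 Bfin M T → Split gs T Y d → ∣ Y ∣ ≡ 3 → PartitionIn C T
    partition-via-triple {T} T₄ split@(Y↓ , _) ∣Y∣≡3 =
      let Y∈gs = available-gate Y↓ (subst (2 ≤_) (sym ∣Y∣≡3) (s≤s (s≤s z≤n)))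
          p , q , r∈ , Y-split = gateSplit circuit Y∈gs
          P∈gs , P⊆Y , ∣P∣≡2 = twoPart-gate circuit Y-split ∣Y∣≡3
          P = twoPart p q
          P⊆T = λ {x} (x∈P : x ∈ₛ P) → Split-⊆ˡ split (P⊆Y x∈P)
          ∣T─P∣≡2 = trans (∣q─p∣ P⊆T) (cong₂ _∸_ (proj₂ (proj₁ T₄)) ∣P∣≡2)
      in P , T ─ P , available-doubleton∈C T₄ (inj₂ P∈gs) P⊆T ∣P∣≡2 ,
         charged∈C r∈ (charge-triple p q ∣Y∣≡3 T₄ (Split-⊆ˡ split))
                      (⊆L⇒IsVertex (L⁺ (inj₂ T₄)) (p─q⊆p T P) ∣T─P∣≡2) ,
         Disjoint-─ P T , p⊆q⇒q≡p∪q─p P⊆T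

    partition-of-quadruple : Depth2 𝒯 Bfin M T → PartitionIn C T
    partition-of-quadruple T₄ with u , w , _ , split@(u↓ , w↓ , u∩w=∅ , T≡u∪w) ← tree-split (inj₂ (inj₂ T₄))
      with i+j≡4⇒i≡j≡2⊎i≡3⊎j≡3 (trans (sym (∣split∣ split)) (proj₂ (proj₁ T₄)))
                  (available-nonempty circuit u↓) (available-nonempty circuit w↓)
    ... | inj₁ (∣u∣≡2 , ∣w∣≡2) =
      u , w , available-doubleton∈C T₄ u↓ (Split-⊆ˡ split) ∣u∣≡2 ,
      available-doubleton∈C T₄ w↓ (Split-⊆ˡ (Split-comm split)) ∣w∣≡2 ,
      u∩w=∅ , T≡u∪w
    ... | inj₂ (inj₁ ∣u∣≡3) = partition-via-triple T₄ split ∣u∣≡3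
    ... | inj₂ (inj₂ ∣w∣≡3) = partition-via-triple T₄ (Split-comm split) ∣w∣≡3

    serves : Serves C
    serves = record
      { doubletons = λ T₂@(T∈𝒯 , ∣T∣≡2) → doubleton-gate∈C (tree-gate (inj₁ T₂)) ∣T∣≡2 (∣T∣≡2 , inj₁ T∈𝒯)
      ; triples    = pair-of-triple
      ; quadruples = partition-of-quadruple
      }
      where
      pair-of-triple : T3' 𝒯 M T → PairIn C T
      pair-of-triple T₃′ =
        let u , w , _ , split = tree-split (inj₂ (inj₁ T₃′))
            P∈gs , P⊆T , ∣P∣≡2 = twoPart-gate circuit split (T3'-size matching T₃′)
        in twoPart u w , doubleton-gate∈C P∈gs ∣P∣≡2 (⊆L⇒IsVertex (L⁺ (inj₁ T₃′)) P⊆T ∣P∣≡2) , P⊆T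

    Unique-C : Unique C
    Unique-C = deduplicate-! _≟ₛ_ _

    vertices-C : All (HVertex 𝒯 Bfin M) C
    vertices-C = All.tabulate λ U∈C →
      IsVertex⇒HVertex (proj₂ (∈-filter⁻ isVertex? {xs = charged}
                                (∈-deduplicate⁻ _≟ₛ_ (filter isVertex? charged) U∈C)))

    ∣L∣+∣C∣≤∣gs∣ : length L + length C ≤ length gs
    ∣L∣+∣C∣≤∣gs∣ = begin
      length L + length C
        ≤⟨ +-mono-≤ ∣L∣≤ ∣C∣≤ ⟩
      length (filter inL? splits) + length charged
        ≤⟨ length-filter+mapMaybe≤ inL? charge (λ {(_ , u , w)} → charge-L u w) splits ⟩
      length splits
        ≡⟨ length-gateSplits circuit ⟩
      length gs ∎
      where
      open ℕ.≤-Reasoning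
      inL? : Decidable (λ (r : Subset n × Subset n × Subset n) → proj₁ r ∈ L)
      inL? r = ∈?[ _≟ₛ_ ] (proj₁ r) L
      ∣L∣≤ : length L ≤ length (filter inL? splits)
      ∣L∣≤ = subst (length L ≤_) (length-map proj₁ (filter inL? splits))
                   (Unique-⊆⇒length≤ _≟ₛ_ L! (All.tabulate λ T∈L →
                     let _ , _ , r∈ , _ = tree-split (inj₂ (L⁻ T∈L)) in ∈-map⁺ proj₁ (∈-filter⁺ inL? r∈ T∈L)))
      ∣C∣≤ : length C ≤ length charged
      ∣C∣≤ = ≤-trans (length-deduplicate _≟ₛ_ (filter isVertex? charged)) (length-filter isVertex? charged)

  solution⇒cover : ∀ {gs} → IsSolution (DepthLe2 𝒯 Bfin M) gs →
                   ∃ λ C → IsVC 𝒯 Bfin M C × Unique C × length L + length C ≤ length gs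
  solution⇒cover (circuit , available) =
    C , (vertices-C , serves⇒covers (All.map (λ (_ , _ , _ , ∣U∣≡2) → ∣U∣≡2) vertices-C) serves) ,
    Unique-C , ∣L∣+∣C∣≤∣gs∣
    where open LowerBound circuit available

lemma10 : (n : ℕ) (𝒯 : List (Subset n)) →
          (∀ T → T ∈ 𝒯 → ∣ T ∣ ≡ 2 ⊎ ∣ T ∣ ≡ 3 ⊎ ∣ T ∣ ≡ 4) →
          (Bfin : Family n) → IntersectRun 𝒯 (Sup3 𝒯) Bfin →
          (M : List (Subset n × Subset n)) → IsMaxMatching 𝒯 Bfin M →
          (optVC : ℕ) → IsOptVC 𝒯 Bfin M optVC →
          (o : ℕ) → IsOpt (DepthLe2 𝒯 Bfin M) o →
          (L : List (Subset n)) → Unique L →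
          (∀ T → (T ∈ L) ⇔ (T3' 𝒯 M T ⊎ Depth2 𝒯 Bfin M T)) →
          optVC + length L ≡ o
lemma10 n 𝒯 _ Bfin run M maximum optVC ((C , C-cover , _ , ∣C∣≡optVC) , cover-minimal)
        o ((gs , solution , ∣gs∣≡o) , solution-minimal) L L! L⇔ = ≤-antisym lower upper
  where
  open Bounds 𝒯 Bfin run M maximum L L! L⇔
  open ℕ.≤-Reasoning

  upper : o ≤ optVC + length L
  upper = begin
    o                    ≤⟨ solution-minimal (L ++ C) (cover⇒solution C-cover) ⟩
    length (L ++ C)      ≡⟨ length-++ L ⟩
    length L + length C  ≡⟨ cong (length L +_) ∣C∣≡optVC ⟩
    length L + optVC     ≡⟨ ℕ.+-comm (length L) optVC ⟩
    optVC + length L     ∎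

  lower : optVC + length L ≤ o
  lower with C′ , C′-cover , C′! , ∣L∣+∣C′∣≤∣gs∣ ← solution⇒cover solution = begin
    optVC + length L     ≡⟨ ℕ.+-comm optVC (length L) ⟩
    length L + optVC     ≤⟨ ℕ.+-monoʳ-≤ (length L) (cover-minimal C′ C′-cover C′!) ⟩
    length L + length C′ ≤⟨ ∣L∣+∣C′∣≤∣gs∣ ⟩
    length gs            ≡⟨ ∣gs∣≡o ⟩
    o                    ∎
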